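{- Every Monma graph is not separable.
   Context: A Monma graph is a finite simple graph consisting of two distinct vertices $u,v$ together with three $u$–$v$ paths that are pairwise internally vertex-disjoint (and no other vertices or links); $u$ and $v$ have degree 3. A graph $G=(V,E)$ is separable if there exist non-negative real weights $w(e)$, $e\in E$, and a threshold $\alpha\in\mathbb{R}$ such that for every $E'\subseteq E$: $\sum_{e\in E'}w(e)\ge\alpha$ if and only if the spanning subgraph $(V,E')$ is connected. -}

module Defs where

open import Level using (Level; _⊔_) renaming (suc to lsuc)
open import Data.Nat using (ℕ; zero; suc)
open import Data.Fin using (Fin; zero; suc)
open import Data.Product using (Σ; ∃; _×_; _,_; proj₁; proj₂; swap)
open import Data.Sum using (_⊎_)
open import Data.Bool using (Bool; true; false; if_then_else_)
open import Data.List using (List; []; _∷_)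
open import Data.List.Membership.Propositional using (_∈_)
open import Data.List.Relation.Unary.Unique.Propositional using (Unique)
open import Relation.Binary.PropositionalEquality using (_≡_; _≢_)
open import Relation.Binary.Core using (Rel)
open import Relation.Binary.Structures using (IsTotalOrder)
open import Algebra.Bundles using (CommutativeRing)
open import Function.Bundles using (_⇔_)

record Graph : Set where
  field
    n : ℕ
    m : ℕ
    ends     : Fin m → Fin n × Fin n
    loopless : ∀ e → proj₁ (ends e) ≢ proj₂ (ends e)
    simple   : ∀ e f → (ends e ≡ ends f ⊎ swap (ends e) ≡ ends f) → e ≡ f

module _ (G : Graph) where
  open Graph G

  Joins : Fin m → Fin n → Fin n → Set
  Joins e x y = ends e ≡ (x , y) ⊎ ends e ≡ (y , x)

  LinkSet : Set
  LinkSet = Fin m → Bool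

  data Reach (S : LinkSet) : Fin n → Fin n → Set where
    here : ∀ {x} → Reach S x x
    step : ∀ {x y z} (e : Fin m) → S e ≡ true → Joins e x y →
           Reach S y z → Reach S x z

  Connected : LinkSet → Set
  Connected S = ∀ x y → Reach S x y

  data WalkSeq : Fin n → Fin n → List (Fin n) → Set where
    single : ∀ {u} → WalkSeq u u (u ∷ [])
    cons   : ∀ {u w v p} (e : Fin m) → Joins e u w →
             WalkSeq w v p → WalkSeq u v (u ∷ p)

  IsPath : Fin n → Fin n → List (Fin n) → Set
  IsPath u v p = WalkSeq u v p × Unique p

  data LinkOn (e : Fin m) : List (Fin n) → Set where
    here  : ∀ {x y p} → Joins e x y → LinkOn e (x ∷ y ∷ p)
    there : ∀ {x p} → LinkOn e p → LinkOn e (x ∷ p)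

  InternallyDisjoint : Fin n → Fin n → List (Fin n) → List (Fin n) → Set
  InternallyDisjoint u v p q = ∀ x → x ∈ p → x ∈ q → x ≡ u ⊎ x ≡ v

  Monma : Set
  Monma =
    Σ (Fin n) λ u → Σ (Fin n) λ v → u ≢ v ×
    Σ (List (Fin n)) λ p₁ → Σ (List (Fin n)) λ p₂ → Σ (List (Fin n)) λ p₃ →
      IsPath u v p₁ × IsPath u v p₂ × IsPath u v p₃ ×
      p₁ ≢ p₂ × p₁ ≢ p₃ × p₂ ≢ p₃ ×
      InternallyDisjoint u v p₁ p₂ × InternallyDisjoint u v p₁ p₃ ×
      InternallyDisjoint u v p₂ p₃ ×
      (∀ x → x ∈ p₁ ⊎ x ∈ p₂ ⊎ x ∈ p₃) ×
      (∀ e → LinkOn e p₁ ⊎ LinkOn e p₂ ⊎ LinkOn e p₃)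

-- Ordered commutative rings (ℝ is an instance): a commutative ring with
-- a total order compatible with + and with multiplication of
-- non-negative elements.

record OrderedCommutativeRing (c ℓ₁ ℓ₂ : Level) : Set (lsuc (c ⊔ ℓ₁ ⊔ ℓ₂)) where
  field
    commutativeRing : CommutativeRing c ℓ₁
  open CommutativeRing commutativeRing public
  field
    _≤_          : Rel Carrier ℓ₂
    isTotalOrder : IsTotalOrder _≈_ _≤_
    +-monoʳ-≤    : ∀ {a b} (c : Carrier) → a ≤ b → (a + c) ≤ (b + c)
    *-nonneg     : ∀ {a b} → 0# ≤ a → 0# ≤ b → 0# ≤ (a * b)

module _ {c ℓ₁ ℓ₂} (R : OrderedCommutativeRing c ℓ₁ ℓ₂) where
  open OrderedCommutativeRing R using (Carrier; 0#; _+_; _≤_)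

  weightSum : ∀ {m} → (Fin m → Bool) → (Fin m → Carrier) → Carrier
  weightSum {zero}  S w = 0#
  weightSum {suc m} S w =
    (if S zero then w zero else 0#) + weightSum (λ i → S (suc i)) (λ i → w (suc i))

  Separable : Graph → Set (c ⊔ ℓ₂)
  Separable G =
    Σ (Fin (Graph.m G) → Carrier) λ w → (∀ e → 0# ≤ w e) ×
    Σ Carrier λ α → ∀ (S : LinkSet G) → (α ≤ weightSum S w) ⇔ Connected G S

-- Two of the three u–v paths have an inner vertex next to u; call them z₁ and z₂, and
-- let aᵢ = uzᵢ and bᵢ be the next link on the same path. Removing {a₁, a₂} or {b₁, b₂}
-- leaves the graph connected, while removing {a₁, b₁} or {a₂, b₂} isolates the degree-two
-- vertex z₁ or z₂. Each link is removed equally often on both sides, so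
-- w(E∖{a₁,a₂}) + w(E∖{b₁,b₂}) = w(E∖{a₁,b₁}) + w(E∖{a₂,b₂}), and two sums at least α
-- cannot add up to two sums below α. The weights need not be non-negative.
module Submission where

open import Defs
open import Level using (Level)
open import Data.Bool using (Bool; true; false; not; _∨_; if_then_else_)
open import Data.Nat using (zero; suc)
open import Data.Fin using (Fin; zero; suc)
open import Data.Fin.Properties using (_≟_)
open import Data.Product using (Σ; _×_; _,_; proj₁; proj₂; swap)
open import Data.Sum using (_⊎_; inj₁; inj₂; [_,_]′; map₂; assocʳ) renaming (swap to ⊎-swap)
open import Data.Empty using (⊥; ⊥-elim)
open import Data.List using (List; []; _∷_)
open import Data.List.Membership.Propositional using (_∈_; _∉_)
open import Data.List.Relation.Unary.Any using (here; there)
import Data.List.Relation.Unary.All as All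
import Data.List.Relation.Unary.AllPairs as AllPairs
open import Data.List.Relation.Unary.Unique.Propositional using (Unique)
open import Relation.Binary.PropositionalEquality
  using (_≡_; _≢_; refl; sym; trans; cong; subst)
open import Relation.Binary.Bundles using (Poset)
open import Relation.Binary.Structures using (IsTotalOrder)
open import Relation.Nullary using (¬_; yes; no)
open import Relation.Nullary.Decidable using (⌊_⌋)
open import Algebra.Bundles using (CommutativeMonoid)
import Algebra.Properties.CommutativeSemigroup as CommutativeSemigroupProperties
import Relation.Binary.Reasoning.PartialOrder as PartialOrderReasoning
import Relation.Binary.Reasoning.Setoid as SetoidReasoning
open import Function using (_∘_; id)
open import Function.Bundles using (Equivalence)

module OrderedCommutativeRingProperties {c ℓ₁ ℓ₂} (R : OrderedCommutativeRing c ℓ₁ ℓ₂) where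
  open OrderedCommutativeRing R
    using ( Carrier; _≈_; _≤_; _+_; -_; 0#; setoid; isTotalOrder; +-monoʳ-≤
          ; +-comm; +-assoc; +-cong; +-congˡ; +-identityʳ; -‿inverseʳ; +-commutativeMonoid )
    renaming (refl to ≈-refl)
  open IsTotalOrder isTotalOrder using (total; isPartialOrder)

  poset : Poset c ℓ₁ ℓ₂
  poset = record { isPartialOrder = isPartialOrder }

  private module ≤-Reasoning = PartialOrderReasoning poset

  +-monoˡ-≤ : ∀ {a b} c → a ≤ b → (c + a) ≤ (c + b)
  +-monoˡ-≤ {a} {b} c a≤b = begin
    c + a ≈⟨ +-comm c a ⟩
    a + c ≤⟨ +-monoʳ-≤ c a≤b ⟩
    b + c ≈⟨ +-comm b c ⟩
    c + b ∎
    where open ≤-Reasoning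

  +-mono-≤ : ∀ {a b c d} → a ≤ b → c ≤ d → (a + c) ≤ (b + d)
  +-mono-≤ {a} {b} {c} {d} a≤b c≤d = begin
    a + c ≤⟨ +-monoʳ-≤ c a≤b ⟩
    b + c ≤⟨ +-monoˡ-≤ b c≤d ⟩
    b + d ∎
    where open ≤-Reasoning

  +-cancelʳ-≤ : ∀ {a b} c → (a + c) ≤ (b + c) → a ≤ b
  +-cancelʳ-≤ {a} {b} c a+c≤b+c = begin
    a             ≈⟨ cancel a ⟨
    a + c + - c   ≤⟨ +-monoʳ-≤ (- c) a+c≤b+c ⟩
    b + c + - c   ≈⟨ cancel b ⟩
    b             ∎
    where
    open ≤-Reasoning
    cancel : ∀ x → x + c + - c ≈ x
    cancel x = begin-equality
      x + c + - c   ≈⟨ +-assoc x c (- c) ⟩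
      x + (c + - c) ≈⟨ +-congˡ (-‿inverseʳ c) ⟩
      x + 0#        ≈⟨ +-identityʳ x ⟩
      x             ∎

  threshold-split : ∀ {α x y z t} → α ≤ x → α ≤ y → x + y ≈ z + t → α ≤ z ⊎ α ≤ t
  threshold-split {α} {x} {y} {z} {t} α≤x α≤y x+y≈z+t with total α t
  ... | inj₁ α≤t = inj₂ α≤t
  ... | inj₂ t≤α = inj₁ (+-cancelʳ-≤ t (begin
    α + t ≤⟨ +-monoˡ-≤ α t≤α ⟩
    α + α ≤⟨ +-mono-≤ α≤x α≤y ⟩
    x + y ≈⟨ x+y≈z+t ⟩
    z + t ∎))
    where open ≤-Reasoning

  weightSum-exchange : ∀ {m} (S₁ S₂ S₃ S₄ : Fin m → Bool) (w : Fin m → Carrier) →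
    (∀ e → (S₁ e , S₂ e) ≡ (S₃ e , S₄ e) ⊎ (S₁ e , S₂ e) ≡ swap (S₃ e , S₄ e)) →
    weightSum R S₁ w + weightSum R S₂ w ≈ weightSum R S₃ w + weightSum R S₄ w
  weightSum-exchange {zero} S₁ S₂ S₃ S₄ w same = ≈-refl
  weightSum-exchange {suc m} S₁ S₂ S₃ S₄ w same = begin
    (term S₁ + rest S₁) + (term S₂ + rest S₂) ≈⟨ interchange _ _ _ _ ⟩
    (term S₁ + term S₂) + (rest S₁ + rest S₂) ≈⟨ +-cong (head-exchange (same zero)) rest-exchange ⟩
    (term S₃ + term S₄) + (rest S₃ + rest S₄) ≈⟨ interchange _ _ _ _ ⟨
    (term S₃ + rest S₃) + (term S₄ + rest S₄) ∎
    where
    open SetoidReasoning setoid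
    open CommutativeSemigroupProperties
      (CommutativeMonoid.commutativeSemigroup +-commutativeMonoid) using (interchange)

    term : (Fin (suc m) → Bool) → Carrier
    term S = if S zero then w zero else 0#

    rest : (Fin (suc m) → Bool) → Carrier
    rest S = weightSum R (S ∘ suc) (w ∘ suc)

    head-exchange : ∀ {b₁ b₂ b₃ b₄} → (b₁ , b₂) ≡ (b₃ , b₄) ⊎ (b₁ , b₂) ≡ (b₄ , b₃) →
      (if b₁ then w zero else 0#) + (if b₂ then w zero else 0#) ≈
      (if b₃ then w zero else 0#) + (if b₄ then w zero else 0#)
    head-exchange (inj₁ refl) = ≈-refl
    head-exchange (inj₂ refl) = +-comm _ _

    rest-exchange : rest S₁ + rest S₂ ≈ rest S₃ + rest S₄
    rest-exchange = weightSum-exchange (S₁ ∘ suc) (S₂ ∘ suc) (S₃ ∘ suc) (S₄ ∘ suc) (w ∘ suc) (same ∘ suc)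

module GraphProperties (G : Graph) where
  open Graph G

  joins-sym : ∀ {e x y} → Joins G e x y → Joins G e y x
  joins-sym (inj₁ p) = inj₂ p
  joins-sym (inj₂ p) = inj₁ p

  joins-injective : ∀ {e f x y} → Joins G e x y → Joins G f x y → e ≡ f
  joins-injective {e} {f} (inj₁ p) (inj₁ q) = simple e f (inj₁ (trans p (sym q)))
  joins-injective {e} {f} (inj₁ p) (inj₂ q) = simple e f (inj₂ (trans (cong swap p) (sym q)))
  joins-injective {e} {f} (inj₂ p) (inj₁ q) = simple e f (inj₂ (trans (cong swap p) (sym q)))
  joins-injective {e} {f} (inj₂ p) (inj₂ q) = simple e f (inj₁ (trans p (sym q)))

  joins-end : ∀ {e x y x' y'} → Joins G e x y → Joins G e x' y' → x ≡ x' ⊎ x ≡ y'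
  joins-end (inj₁ p) (inj₁ q) = inj₁ (cong proj₁ (trans (sym p) q))
  joins-end (inj₁ p) (inj₂ q) = inj₂ (cong proj₁ (trans (sym p) q))
  joins-end (inj₂ p) (inj₁ q) = inj₂ (cong proj₂ (trans (sym p) q))
  joins-end (inj₂ p) (inj₂ q) = inj₁ (cong proj₂ (trans (sym p) q))

  linkOn-incident : ∀ {e x y p} → LinkOn G e p → Joins G e x y → x ∈ p
  linkOn-incident (here j') j with joins-end j j'
  ... | inj₁ refl = here refl
  ... | inj₂ refl = there (here refl)
  linkOn-incident (there l) j = there (linkOn-incident l j)

  ¬linkOn : ∀ {e x y p} → Joins G e x y → x ∉ p → ¬ LinkOn G e p
  ¬linkOn j x∉p l = x∉p (linkOn-incident l j)

  walk-last : ∀ {x v p} → WalkSeq G x v p → v ∈ p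
  walk-last single = here refl
  walk-last (cons e j W) = there (walk-last W)

  disjoint-sym : ∀ {u v p q} → InternallyDisjoint G u v p q → InternallyDisjoint G u v q p
  disjoint-sym I x x∈q x∈p = I x x∈p x∈q

  inner-∉ : ∀ {u v p q x} → InternallyDisjoint G u v p q → x ∈ p → x ≢ u → x ≢ v → x ∉ q
  inner-∉ I x∈p x≢u x≢v x∈q = [ x≢u , x≢v ]′ (I _ x∈p x∈q)

  LinksIn : LinkSet G → List (Fin n) → Set
  LinksIn S p = ∀ e → LinkOn G e p → S e ≡ true

  reach-trans : ∀ {S x y z} → Reach G S x y → Reach G S y z → Reach G S x z
  reach-trans here r = r
  reach-trans (step e s j r) r' = step e s j (reach-trans r r')

  reach-sym : ∀ {S x y} → Reach G S x y → Reach G S y x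
  reach-sym here = here
  reach-sym (step e s j r) = reach-trans (reach-sym r) (step e s (joins-sym j) here)

  walk-reach : ∀ {S x v p} → WalkSeq G x v p → LinksIn S p → Reach G S x v
  walk-reach single h = here
  walk-reach (cons e j single) h = step e (h e (here j)) j here
  walk-reach (cons e j W@(cons _ _ _)) h = step e (h e (here j)) j (walk-reach W (λ f → h f ∘ there))

  walk-reach-from : ∀ {S x y v p} → WalkSeq G y v p → LinksIn S p → x ∈ p → Reach G S x v
  walk-reach-from single h (here refl) = here
  walk-reach-from W@(cons e j _) h (here refl) = walk-reach W h
  walk-reach-from (cons e j W) h (there x∈p) = walk-reach-from W (λ f → h f ∘ there) x∈p

  connected-if-all-reach : ∀ {S v} → (∀ x → Reach G S x v) → Connected G S
  connected-if-all-reach reach x y = reach-trans (reach x) (reach-sym (reach y))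

  isolated-disconnects : ∀ {S z x} → (∀ e y → Joins G e z y → S e ≡ false) → z ≢ x →
                         ¬ Connected G S
  isolated-disconnects {S} {z} {x} cut z≢x connected with connected z x
  ... | here = z≢x refl
  ... | step e s j _ with trans (sym s) (cut e _ j)
  ...   | ()

  without : Fin m → Fin m → LinkSet G
  without a b e = not (⌊ e ≟ a ⌋ ∨ ⌊ e ≟ b ⌋)

  without-true : ∀ {a b e} → e ≢ a → e ≢ b → without a b e ≡ true
  without-true {a} {b} {e} e≢a e≢b with e ≟ a | e ≟ b
  ... | yes e≡a | _       = ⊥-elim (e≢a e≡a)
  ... | no _    | yes e≡b = ⊥-elim (e≢b e≡b)
  ... | no _    | no _    = refl

  without-false : ∀ {a b e} → e ≡ a ⊎ e ≡ b → without a b e ≡ false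
  without-false {a} {b} {e} e∈ab with e ≟ a | e ≟ b
  ... | yes _ | _        = refl
  ... | no _  | yes _    = refl
  ... | no e≢a | no e≢b  = ⊥-elim ([ e≢a , e≢b ]′ e∈ab)

  without-linksIn : ∀ {a b p} → ¬ LinkOn G a p → ¬ LinkOn G b p → LinksIn (without a b) p
  without-linksIn {a} {b} a∉p b∉p e l = without-true {a} {b} {e} (λ { refl → a∉p l }) (λ { refl → b∉p l })

  without-exchange : ∀ {a₁ a₂ b₁ b₂} → a₁ ≢ a₂ → b₁ ≢ b₂ → a₁ ≢ b₁ → a₂ ≢ b₂ → ∀ e →
    (without a₁ a₂ e , without b₁ b₂ e) ≡ (without a₁ b₁ e , without a₂ b₂ e) ⊎
    (without a₁ a₂ e , without b₁ b₂ e) ≡ swap (without a₁ b₁ e , without a₂ b₂ e)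
  without-exchange {a₁} {a₂} {b₁} {b₂} a₁≢a₂ b₁≢b₂ a₁≢b₁ a₂≢b₂ e
    with e ≟ a₁ | e ≟ a₂ | e ≟ b₁ | e ≟ b₂
  ... | yes p | yes q | _     | _     = ⊥-elim (a₁≢a₂ (trans (sym p) q))
  ... | _     | _     | yes p | yes q = ⊥-elim (b₁≢b₂ (trans (sym p) q))
  ... | yes p | _     | yes q | _     = ⊥-elim (a₁≢b₁ (trans (sym p) q))
  ... | _     | yes p | _     | yes q = ⊥-elim (a₂≢b₂ (trans (sym p) q))
  ... | yes _ | no _  | no _  | yes _ = inj₁ refl
  ... | yes _ | no _  | no _  | no _  = inj₁ refl
  ... | no _  | yes _ | yes _ | no _  = inj₁ refl
  ... | no _  | yes _ | no _  | no _  = inj₂ refl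
  ... | no _  | no _  | yes _ | no _  = inj₂ refl
  ... | no _  | no _  | no _  | yes _ = inj₁ refl
  ... | no _  | no _  | no _  | no _  = inj₁ refl

  data PathShape (u v : Fin n) : List (Fin n) → Set where
    direct : PathShape u v (u ∷ v ∷ [])
    detour : ∀ z z' r → PathShape u v (u ∷ z ∷ z' ∷ r)

  pathShape : ∀ {u v p} → u ≢ v → WalkSeq G u v p → PathShape u v p
  pathShape u≢v single = ⊥-elim (u≢v refl)
  pathShape u≢v (cons e j single) = direct
  pathShape u≢v (cons e j (cons _ _ single)) = detour _ _ _
  pathShape u≢v (cons e j (cons _ _ (cons _ _ _))) = detour _ _ _

  firstLinks : ∀ {u v z z' r} → WalkSeq G u v (u ∷ z ∷ z' ∷ r) →
    Σ (Fin m) λ a → Σ (Fin m) λ b → Joins G a u z × Joins G b z z' × WalkSeq G z' v (z' ∷ r)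
  firstLinks (cons a j (cons b k single)) = a , b , j , k , single
  firstLinks (cons a j (cons b k W@(cons _ _ _))) = a , b , j , k , W

  module Detour {u v z z' r a b}
    (ja : Joins G a u z) (kb : Joins G b z z')
    (W : WalkSeq G z' v (z' ∷ r)) (U : Unique (u ∷ z ∷ z' ∷ r)) where

    u∉tail : u ∉ z ∷ z' ∷ r
    u∉tail u∈tail = All.lookup (AllPairs.head U) u∈tail refl

    z∉rest : z ∉ z' ∷ r
    z∉rest z∈rest = All.lookup (AllPairs.head (AllPairs.tail U)) z∈rest refl

    z≢u : z ≢ u
    z≢u z≡u = u∉tail (here (sym z≡u))

    z≢v : z ≢ v
    z≢v z≡v = z∉rest (subst (_∈ z' ∷ r) (sym z≡v) (walk-last W))

    a≢b : a ≢ b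
    a≢b refl = ¬linkOn ja u∉tail (here kb)

    links-at-z : ∀ {e y} → LinkOn G e (u ∷ z ∷ z' ∷ r) → Joins G e z y → e ≡ a ⊎ e ≡ b
    links-at-z (here j') j = inj₁ (joins-injective j' ja)
    links-at-z (there (here j')) j = inj₂ (joins-injective j' kb)
    links-at-z (there (there l)) j = ⊥-elim (¬linkOn j z∉rest l)

    reach-via-tail : ∀ {S x} → Reach G S u v → LinksIn S (z ∷ z' ∷ r) →
                     x ∈ u ∷ z ∷ z' ∷ r → Reach G S x v
    reach-via-tail uv h (here refl) = uv
    reach-via-tail uv h (there x∈tail) = walk-reach-from (cons b kb W) h x∈tail

    reach-via-first : ∀ {S x} → Reach G S u v → S a ≡ true → LinksIn S (z' ∷ r) →
                      x ∈ u ∷ z ∷ z' ∷ r → Reach G S x v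
    reach-via-first uv sa h (here refl) = uv
    reach-via-first uv sa h (there (here refl)) = step a sa (joins-sym ja) uv
    reach-via-first uv sa h (there (there x∈rest)) = walk-reach-from W h x∈rest

  module TwoDetours {u v z₁ z₁' r₁ a₁ b₁ z₂ z₂' r₂ a₂ b₂ p₃}
    (ja₁ : Joins G a₁ u z₁) (kb₁ : Joins G b₁ z₁ z₁')
    (W₁ : WalkSeq G z₁' v (z₁' ∷ r₁)) (U₁ : Unique (u ∷ z₁ ∷ z₁' ∷ r₁))
    (ja₂ : Joins G a₂ u z₂) (kb₂ : Joins G b₂ z₂ z₂')
    (W₂ : WalkSeq G z₂' v (z₂' ∷ r₂)) (U₂ : Unique (u ∷ z₂ ∷ z₂' ∷ r₂))
    (W₃ : WalkSeq G u v p₃)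
    (I₁₂ : InternallyDisjoint G u v (u ∷ z₁ ∷ z₁' ∷ r₁) (u ∷ z₂ ∷ z₂' ∷ r₂))
    (I₁₃ : InternallyDisjoint G u v (u ∷ z₁ ∷ z₁' ∷ r₁) p₃)
    (I₂₃ : InternallyDisjoint G u v (u ∷ z₂ ∷ z₂' ∷ r₂) p₃)
    (vertices : ∀ x → x ∈ u ∷ z₁ ∷ z₁' ∷ r₁ ⊎ x ∈ u ∷ z₂ ∷ z₂' ∷ r₂ ⊎ x ∈ p₃)
    (links : ∀ e → LinkOn G e (u ∷ z₁ ∷ z₁' ∷ r₁) ⊎ LinkOn G e (u ∷ z₂ ∷ z₂' ∷ r₂) ⊎ LinkOn G e p₃)
    where

    module D₁ = Detour ja₁ kb₁ W₁ U₁
    module D₂ = Detour ja₂ kb₂ W₂ U₂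

    z₁∉p₂ : z₁ ∉ u ∷ z₂ ∷ z₂' ∷ r₂
    z₁∉p₂ = inner-∉ I₁₂ (there (here refl)) D₁.z≢u D₁.z≢v

    z₁∉p₃ : z₁ ∉ p₃
    z₁∉p₃ = inner-∉ I₁₃ (there (here refl)) D₁.z≢u D₁.z≢v

    z₂∉p₁ : z₂ ∉ u ∷ z₁ ∷ z₁' ∷ r₁
    z₂∉p₁ = inner-∉ (disjoint-sym I₁₂) (there (here refl)) D₂.z≢u D₂.z≢v

    z₂∉p₃ : z₂ ∉ p₃
    z₂∉p₃ = inner-∉ I₂₃ (there (here refl)) D₂.z≢u D₂.z≢v

    a₁≢a₂ : a₁ ≢ a₂
    a₁≢a₂ refl = ¬linkOn (joins-sym ja₁) z₁∉p₂ (here ja₂)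

    b₁≢b₂ : b₁ ≢ b₂
    b₁≢b₂ refl = ¬linkOn kb₁ z₁∉p₂ (there (here kb₂))

    a₁≢b₂ : a₁ ≢ b₂
    a₁≢b₂ refl = ¬linkOn kb₂ z₂∉p₁ (here ja₁)

    a₂≢b₁ : a₂ ≢ b₁
    a₂≢b₁ refl = ¬linkOn kb₁ z₁∉p₂ (here ja₂)

    cut₁ : ¬ Connected G (without a₁ b₁)
    cut₁ = isolated-disconnects (λ e y j → without-false (D₁.links-at-z (on-p₁ j) j)) D₁.z≢u
      where
      on-p₁ : ∀ {e y} → Joins G e z₁ y → LinkOn G e (u ∷ z₁ ∷ z₁' ∷ r₁)
      on-p₁ {e} j = [ id , [ ⊥-elim ∘ ¬linkOn j z₁∉p₂ , ⊥-elim ∘ ¬linkOn j z₁∉p₃ ]′ ]′ (links e)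

    cut₂ : ¬ Connected G (without a₂ b₂)
    cut₂ = isolated-disconnects (λ e y j → without-false (D₂.links-at-z (on-p₂ j) j)) D₂.z≢u
      where
      on-p₂ : ∀ {e y} → Joins G e z₂ y → LinkOn G e (u ∷ z₂ ∷ z₂' ∷ r₂)
      on-p₂ {e} j = [ ⊥-elim ∘ ¬linkOn j z₂∉p₁ , [ id , ⊥-elim ∘ ¬linkOn j z₂∉p₃ ]′ ]′ (links e)

    connected-without-firsts : Connected G (without a₁ a₂)
    connected-without-firsts = connected-if-all-reach λ x →
      [ D₁.reach-via-tail uv (without-linksIn (¬linkOn ja₁ D₁.u∉tail) (¬linkOn (joins-sym ja₂) (z₂∉p₁ ∘ there)))
      , [ D₂.reach-via-tail uv (without-linksIn (¬linkOn (joins-sym ja₁) (z₁∉p₂ ∘ there)) (¬linkOn ja₂ D₂.u∉tail))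
        , walk-reach-from W₃ on-p₃ ]′ ]′ (vertices x)
      where
      on-p₃ : LinksIn (without a₁ a₂) p₃
      on-p₃ = without-linksIn (¬linkOn (joins-sym ja₁) z₁∉p₃) (¬linkOn (joins-sym ja₂) z₂∉p₃)
      uv : Reach G (without a₁ a₂) u v
      uv = walk-reach W₃ on-p₃

    connected-without-seconds : Connected G (without b₁ b₂)
    connected-without-seconds = connected-if-all-reach λ x →
      [ D₁.reach-via-first uv (without-true D₁.a≢b a₁≢b₂)
          (without-linksIn (¬linkOn kb₁ D₁.z∉rest) (¬linkOn kb₂ (λ z₂∈ → z₂∉p₁ (there (there z₂∈)))))
      , [ D₂.reach-via-first uv (without-true a₂≢b₁ D₂.a≢b)
            (without-linksIn (¬linkOn kb₁ (λ z₁∈ → z₁∉p₂ (there (there z₁∈)))) (¬linkOn kb₂ D₂.z∉rest))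
        , walk-reach-from W₃ on-p₃ ]′ ]′ (vertices x)
      where
      on-p₃ : LinksIn (without b₁ b₂) p₃
      on-p₃ = without-linksIn (¬linkOn kb₁ z₁∉p₃) (¬linkOn kb₂ z₂∉p₃)
      uv : Reach G (without b₁ b₂) u v
      uv = walk-reach W₃ on-p₃

    not-separable : ∀ {c ℓ₁ ℓ₂} (R : OrderedCommutativeRing c ℓ₁ ℓ₂) → ¬ Separable R G
    not-separable R (w , _ , α , iff) =
      [ cut₁ ∘ Equivalence.to (iff (without a₁ b₁)) , cut₂ ∘ Equivalence.to (iff (without a₂ b₂)) ]′
        (threshold-split (Equivalence.from (iff (without a₁ a₂)) connected-without-firsts)
                         (Equivalence.from (iff (without b₁ b₂)) connected-without-seconds)
                         (weightSum-exchange _ _ _ _ w (without-exchange a₁≢a₂ b₁≢b₂ D₁.a≢b D₂.a≢b)))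
      where open OrderedCommutativeRingProperties R

  detours-not-separable : ∀ {c ℓ₁ ℓ₂} (R : OrderedCommutativeRing c ℓ₁ ℓ₂)
    {u v z₁ z₁' r₁ z₂ z₂' r₂ p₃} →
    WalkSeq G u v (u ∷ z₁ ∷ z₁' ∷ r₁) → Unique (u ∷ z₁ ∷ z₁' ∷ r₁) →
    WalkSeq G u v (u ∷ z₂ ∷ z₂' ∷ r₂) → Unique (u ∷ z₂ ∷ z₂' ∷ r₂) →
    WalkSeq G u v p₃ →
    InternallyDisjoint G u v (u ∷ z₁ ∷ z₁' ∷ r₁) (u ∷ z₂ ∷ z₂' ∷ r₂) →
    InternallyDisjoint G u v (u ∷ z₁ ∷ z₁' ∷ r₁) p₃ →
    InternallyDisjoint G u v (u ∷ z₂ ∷ z₂' ∷ r₂) p₃ →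
    (∀ x → x ∈ u ∷ z₁ ∷ z₁' ∷ r₁ ⊎ x ∈ u ∷ z₂ ∷ z₂' ∷ r₂ ⊎ x ∈ p₃) →
    (∀ e → LinkOn G e (u ∷ z₁ ∷ z₁' ∷ r₁) ⊎ LinkOn G e (u ∷ z₂ ∷ z₂' ∷ r₂) ⊎ LinkOn G e p₃) →
    ¬ Separable R G
  detours-not-separable R W₁ U₁ W₂ U₂ W₃ I₁₂ I₁₃ I₂₃ vertices links
    with firstLinks W₁ | firstLinks W₂
  ... | _ , _ , ja₁ , kb₁ , W₁' | _ , _ , ja₂ , kb₂ , W₂' =
    TwoDetours.not-separable ja₁ kb₁ W₁' U₁ ja₂ kb₂ W₂' U₂ W₃ I₁₂ I₁₃ I₂₃ vertices links R

  -- Distinct paths cannot both be the single link uv, so two of the three are detours.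
  monma-not-separable : ∀ {c ℓ₁ ℓ₂} (R : OrderedCommutativeRing c ℓ₁ ℓ₂) → Monma G → ¬ Separable R G
  monma-not-separable R (u , v , u≢v , p₁ , p₂ , p₃ , (W₁ , U₁) , (W₂ , U₂) , (W₃ , U₃) ,
                         p₁≢p₂ , p₁≢p₃ , p₂≢p₃ , I₁₂ , I₁₃ , I₂₃ , vertices , links)
    with pathShape u≢v W₁ | pathShape u≢v W₂ | pathShape u≢v W₃
  ... | direct       | direct       | _            = ⊥-elim (p₁≢p₂ refl)
  ... | direct       | detour _ _ _ | direct       = ⊥-elim (p₁≢p₃ refl)
  ... | detour _ _ _ | direct       | direct       = ⊥-elim (p₂≢p₃ refl)
  ... | direct       | detour _ _ _ | detour _ _ _ =
    detours-not-separable R W₂ U₂ W₃ U₃ W₁ I₂₃ (disjoint-sym I₁₂) (disjoint-sym I₁₃)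
      (assocʳ ∘ ⊎-swap ∘ vertices) (assocʳ ∘ ⊎-swap ∘ links)
  ... | detour _ _ _ | direct       | detour _ _ _ =
    detours-not-separable R W₁ U₁ W₃ U₃ W₂ I₁₃ I₁₂ (disjoint-sym I₂₃)
      (map₂ ⊎-swap ∘ vertices) (map₂ ⊎-swap ∘ links)
  ... | detour _ _ _ | detour _ _ _ | _            =
    detours-not-separable R W₁ U₁ W₂ U₂ W₃ I₁₂ I₁₃ I₂₃ vertices links

lemma4 : ∀ {c ℓ₁ ℓ₂ : Level} (R : OrderedCommutativeRing c ℓ₁ ℓ₂) (G : Graph) →
    Monma G → ¬ Separable R G
lemma4 R G = GraphProperties.monma-not-separable G R
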